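{- Let $\mathcal A$ be an associative unital $\mathbb C$-algebra, $A,B\in\mathcal A$, and $\epsilon\in\mathbb C\setminus\{0\}$. Then the following are equivalent: (i) $[B,A]=\epsilon(A+B)$; (ii) for all $n\in\mathbb N$, $(A+B)^n=\sum_{k=0}^n{n\brack k}\epsilon^{n-k}\sum_{j=0}^k\binom{k}{j}A^jB^{k-j}$; (iii) for all $t$, $e^{At}e^{Bt}=e^{(A+B)\frac{1-e^{ -\epsilon t}}{\epsilon}}$.
   Context: $[X,Y]=XY-YX$; $e^X=\sum_{n\ge0}X^n/n!$. ${n\brack k}$ denotes the unsigned Stirling numbers of the first kind, defined by $x(x-1)\cdots(x-n+1)=\sum_{k=0}^n{n\brack k}(-1)^{n-k}x^k$. Series are treated formally; identities in $t$ are equalities of formal power series in $t$ with coefficients in $\mathcal A$. -}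

module Defs where

open import Level using (Level; _⊔_) renaming (suc to lsuc)
open import Data.Nat as ℕ using (ℕ; zero; suc; _∸_)
open import Data.Nat.Combinatorics using (_C_)
open import Data.Integer as ℤ using (ℤ; +_; -[1+_])
open import Relation.Nullary using (¬_)
open import Algebra.Bundles using (CommutativeRing; Ring)

-- Unsigned Stirling numbers of the first kind, as in the paper:
-- x(x-1)...(x-n+1) = Σ_k [n k] (-1)^(n-k) x^k.
-- fallingCoeff n k = coefficient of x^k in x(x-1)...(x-n+1) (in ℤ),
-- computed by multiplying the polynomial by (x - n) at each step.

fallingCoeff : ℕ → ℕ → ℤ
fallingCoeff zero    zero    = + 1
fallingCoeff zero    (suc k) = + 0
fallingCoeff (suc n) zero    = ℤ.- (+ n ℤ.* fallingCoeff n zero)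
fallingCoeff (suc n) (suc k) = fallingCoeff n k ℤ.- (+ n ℤ.* fallingCoeff n (suc k))

signℤ : ℕ → ℤ
signℤ zero    = + 1
signℤ (suc m) = ℤ.- signℤ m

stirling1 : ℕ → ℕ → ℤ
stirling1 n k = signℤ (n ∸ k) ℤ.* fallingCoeff n k

module _ {c ℓ : Level} (K : CommutativeRing c ℓ) where
  open CommutativeRing K

  natK : ℕ → Carrier
  natK zero    = 0#
  natK (suc n) = 1# + natK n

  record IsFieldChar0 : Set (c ⊔ ℓ) where
    field
      1≉0     : ¬ (1# ≈ 0#)
      inv     : (x : Carrier) → ¬ (x ≈ 0#) → Carrier
      inverse : ∀ x (p : ¬ (x ≈ 0#)) → (x * inv x p) ≈ 1#
      char0   : ∀ n → ¬ (natK (suc n) ≈ 0#)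

  -- An associative unital K-algebra: a ring 𝒜 with a ring homomorphism
  -- ι : K → 𝒜 landing in the centre of 𝒜 (scalar multiplication c·x = ι c * x).
  record Algebra (a ℓa : Level) : Set (c ⊔ ℓ ⊔ lsuc (a ⊔ ℓa)) where
    field
      algRing : Ring a ℓa
    module R = Ring algRing
    field
      ι       : Carrier → R.Carrier
      ι-cong  : ∀ {x y} → x ≈ y → ι x R.≈ ι y
      ι-+     : ∀ x y → ι (x + y) R.≈ (ι x R.+ ι y)
      ι-*     : ∀ x y → ι (x * y) R.≈ (ι x R.* ι y)
      ι-1     : ι 1# R.≈ R.1#
      central : ∀ x (u : R.Carrier) → (ι x R.* u) R.≈ (u R.* ι x)

module Ops {c ℓ a ℓa : Level} (K : CommutativeRing c ℓ) (F : IsFieldChar0 K)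
           (𝒜 : Algebra K a ℓa) where
  private module K = CommutativeRing K
  open IsFieldChar0 F
  open Algebra 𝒜 using (ι; algRing)
  open Ring algRing hiding (zero)

  pow : Carrier → ℕ → Carrier
  pow x zero    = 1#
  pow x (suc n) = x * pow x n

  powK : K.Carrier → ℕ → K.Carrier
  powK x zero    = K.1#
  powK x (suc n) = x K.* powK x n

  natA : ℕ → Carrier
  natA zero    = 0#
  natA (suc n) = 1# + natA n

  intA : ℤ → Carrier
  intA (+ n)    = natA n
  intA -[1+ n ] = - natA (suc n)

  sumTo : ℕ → (ℕ → Carrier) → Carrier
  sumTo zero    f = f zero
  sumTo (suc n) f = sumTo n f + f (suc n)

  invFact : ℕ → K.Carrier
  invFact zero    = K.1#
  invFact (suc n) = invFact n K.* inv (natK K (suc n)) (char0 n)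

  [_,_] : Carrier → Carrier → Carrier
  [ X , Y ] = X * Y - Y * X

  -- formal power series in t with coefficients in 𝒜 (coefficient of t^n)
  Series : Set a
  Series = ℕ → Carrier

  _≈S_ : Series → Series → Set ℓa
  f ≈S g = ∀ n → f n ≈ g n

  linT : Carrier → Series
  linT X zero          = 0#
  linT X (suc zero)    = X
  linT X (suc (suc n)) = 0#

  oneS : Series
  oneS zero    = 1#
  oneS (suc n) = 0#

  _-S_ : Series → Series → Series
  (f -S g) n = f n - g n

  _·S_ : Carrier → Series → Series
  (X ·S f) n = X * f n

  _*S_ : Series → Series → Series
  (f *S g) n = sumTo n (λ i → f i * g (n ∸ i))

  powS : Series → ℕ → Series
  powS f zero    = oneS
  powS f (suc m) = f *S powS f m

  -- e^S = Σ_m S^m / m!, for S with zero constant term (the only case used);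
  -- then S^m has no terms below t^m, so the coefficient of t^n is a finite sum.
  expS : Series → Series
  expS S n = sumTo n (λ m → ι (invFact m) * powS S m n)

  module _ (A B : Carrier) (ε : K.Carrier) (ε≉0 : ¬ (ε K.≈ K.0#)) where

    CondI : Set ℓa
    CondI = [ B , A ] ≈ ι ε * (A + B)

    CondII : Set ℓa
    CondII = ∀ n → pow (A + B) n ≈
      sumTo n (λ k → intA (stirling1 n k) * ι (powK ε (n ∸ k))
                       * sumTo k (λ j → natA (k C j) * pow A j * pow B (k ∸ j)))

    shiftT : Series
    shiftT = ι (inv ε ε≉0) ·S (oneS -S expS (linT (ι (K.- ε))))

    CondIII : Set ℓa
    CondIII = (expS (linT A) *S expS (linT B)) ≈S expS ((A + B) ·S shiftT)

-- Write S = A + B. Condition (i) says [B,S] = εS, equivalently BS = SB + εS and AS = SA - εS.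
--
-- (i) ⇔ (ii): by the recurrence [n+1,k+1] = [n,k] + n[n,k+1] and a noncommutative Pascal rule, the
-- right-hand sides M n of (ii) satisfy M (n+1) = A M n + M n B + n ε M n. Under (i), B S^n = S^n B + n ε S^n,
-- so S^n satisfies the same recurrence; conversely, (ii) for n = 2 is (i).
--
-- (i) ⇔ (iii): with f′ the formal derivative, e^{At}e^{Bt} solves f′ = A f + f B, f(0) = 1, and such a
-- solution is unique in characteristic zero. For v = S(1 - e^{-εt})/ε one has v′ = S - εv, and (i) gives
-- A v^m + v^m B = S v^m - mε v^m, from which e^v solves the same equation. Conversely, comparing the
-- t² coefficients of both sides of (iii) gives (i).

module Submission where

open import Defs
open import Level using (Level; _⊔_)
open import Data.Product using (_×_; _,_)
open import Relation.Nullary using (¬_; yes; no)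
open import Data.Empty using (⊥-elim)
open import Function.Base using (_∘_)
open import Function.Bundles using (_⇔_; mk⇔)
open import Algebra.Bundles using (CommutativeRing; Ring)
open import Data.Nat as ℕ using (ℕ; zero; suc; _∸_; _≤_; _<_; z≤n; s≤s)
import Data.Nat.Properties as ℕₚ
open import Data.Nat.Combinatorics using (_C_; nCk+nC[k+1]≡[n+1]C[k+1]; k>n⇒nCk≡0)
open import Data.Integer as ℤ using (ℤ; +_)
import Relation.Binary.PropositionalEquality as P
open P using (_≡_; _≢_)

module UnsignedStirling where
  open import Data.Integer.Tactic.RingSolver using (solve-∀)
  import Data.Integer.Properties as ℤₚ
  open P using (refl; cong; cong₂; module ≡-Reasoning)
  open ≡-Reasoning

  stirling : ℕ → ℕ → ℕ
  stirling zero    zero    = 1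
  stirling zero    (suc k) = 0
  stirling (suc n) zero    = n ℕ.* stirling n zero
  stirling (suc n) (suc k) = stirling n k ℕ.+ n ℕ.* stirling n (suc k)

  n<k⇒stirling≡0 : ∀ {n k} → n < k → stirling n k ≡ 0
  n<k⇒stirling≡0 {zero}  {suc k} _       = refl
  n<k⇒stirling≡0 {suc n} {suc k} (s≤s p)
    rewrite n<k⇒stirling≡0 p | n<k⇒stirling≡0 (ℕₚ.m≤n⇒m≤1+n p) = ℕₚ.*-zeroʳ n

  stirling[1+n,0]≡0 : ∀ n → stirling (suc n) 0 ≡ 0
  stirling[1+n,0]≡0 zero    = refl
  stirling[1+n,0]≡0 (suc n) rewrite stirling[1+n,0]≡0 n = ℕₚ.*-zeroʳ (suc n)

  signℤ-involutive : ∀ m x → signℤ m ℤ.* (signℤ m ℤ.* x) ≡ x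
  signℤ-involutive zero    x = P.trans (ℤₚ.*-identityˡ _) (ℤₚ.*-identityˡ x)
  signℤ-involutive (suc m) x = P.trans (negate-twice (signℤ m) x) (signℤ-involutive m x)
    where
      negate-twice : ∀ σ x → (ℤ.- σ) ℤ.* ((ℤ.- σ) ℤ.* x) ≡ σ ℤ.* (σ ℤ.* x)
      negate-twice = solve-∀

  -- When n ≤ k the factor stirling n (suc k) vanishes, so the sign does not matter.
  signℤ-∸-suc : ∀ n k → signℤ (n ∸ suc k) ℤ.* + stirling n (suc k)
                        ≡ ℤ.- (signℤ (n ∸ k) ℤ.* + stirling n (suc k))
  signℤ-∸-suc n k with k ℕₚ.<? n
  ... | yes k<n = begin
    σ ℤ.* s                  ≡⟨ negate-negate σ s ⟩
    ℤ.- ((ℤ.- σ) ℤ.* s)      ≡⟨ cong (λ τ → ℤ.- (τ ℤ.* s)) (cong signℤ (P.sym (ℕₚ.+-∸-assoc 1 k<n))) ⟩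
    ℤ.- (signℤ (n ∸ k) ℤ.* s) ∎
    where
      σ s : ℤ
      σ = signℤ (n ∸ suc k)
      s = + stirling n (suc k)
      negate-negate : ∀ σ s → σ ℤ.* s ≡ ℤ.- ((ℤ.- σ) ℤ.* s)
      negate-negate = solve-∀
  ... | no k≮n
    rewrite n<k⇒stirling≡0 {n} {suc k} (s≤s (ℕₚ.≮⇒≥ k≮n))
          | ℤₚ.*-zeroʳ (signℤ (n ∸ suc k)) | ℤₚ.*-zeroʳ (signℤ (n ∸ k)) = refl

  fallingCoeff≡±stirling : ∀ n k → fallingCoeff n k ≡ signℤ (n ∸ k) ℤ.* + stirling n k
  fallingCoeff≡±stirling zero    zero    = refl
  fallingCoeff≡±stirling zero    (suc k) = refl
  fallingCoeff≡±stirling (suc n) zero    = begin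
    ℤ.- (+ n ℤ.* fallingCoeff n 0)           ≡⟨ cong (λ x → ℤ.- (+ n ℤ.* x)) (fallingCoeff≡±stirling n 0) ⟩
    ℤ.- (+ n ℤ.* (signℤ n ℤ.* + s))          ≡⟨ rearrange (signℤ n) (+ n) (+ s) ⟩
    ℤ.- signℤ n ℤ.* (+ n ℤ.* + s)            ≡⟨ cong (ℤ.- signℤ n ℤ.*_) (P.sym (ℤₚ.pos-* n s)) ⟩
    ℤ.- signℤ n ℤ.* + (n ℕ.* s)              ∎
    where
      s : ℕ
      s = stirling n 0
      rearrange : ∀ σ n s → ℤ.- (n ℤ.* (σ ℤ.* s)) ≡ ℤ.- σ ℤ.* (n ℤ.* s)
      rearrange = solve-∀
  fallingCoeff≡±stirling (suc n) (suc k) = begin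
    fallingCoeff n k ℤ.- + n ℤ.* fallingCoeff n (suc k)
      ≡⟨ cong₂ (λ x y → x ℤ.- + n ℤ.* y) (fallingCoeff≡±stirling n k) (fallingCoeff≡±stirling n (suc k)) ⟩
    σ ℤ.* + s₀ ℤ.- + n ℤ.* (signℤ (n ∸ suc k) ℤ.* + s₁)
      ≡⟨ cong (λ y → σ ℤ.* + s₀ ℤ.- + n ℤ.* y) (signℤ-∸-suc n k) ⟩
    σ ℤ.* + s₀ ℤ.- + n ℤ.* ℤ.- (σ ℤ.* + s₁)  ≡⟨ factor σ (+ s₀) (+ n) (+ s₁) ⟩
    σ ℤ.* (+ s₀ ℤ.+ + n ℤ.* + s₁)           ≡⟨ cong (λ y → σ ℤ.* (+ s₀ ℤ.+ y)) (P.sym (ℤₚ.pos-* n s₁)) ⟩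
    σ ℤ.* (+ s₀ ℤ.+ + (n ℕ.* s₁))           ≡⟨ cong (σ ℤ.*_) (P.sym (ℤₚ.pos-+ s₀ (n ℕ.* s₁))) ⟩
    σ ℤ.* + (s₀ ℕ.+ n ℕ.* s₁)               ∎
    where
      σ : ℤ
      σ  = signℤ (n ∸ k)
      s₀ s₁ : ℕ
      s₀ = stirling n k
      s₁ = stirling n (suc k)
      factor : ∀ σ a n b → σ ℤ.* a ℤ.- n ℤ.* ℤ.- (σ ℤ.* b) ≡ σ ℤ.* (a ℤ.+ n ℤ.* b)
      factor = solve-∀

  stirling1≡stirling : ∀ n k → stirling1 n k ≡ + stirling n k
  stirling1≡stirling n k = begin
    signℤ (n ∸ k) ℤ.* fallingCoeff n k                   ≡⟨ cong (signℤ (n ∸ k) ℤ.*_) (fallingCoeff≡±stirling n k) ⟩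
    signℤ (n ∸ k) ℤ.* (signℤ (n ∸ k) ℤ.* + stirling n k) ≡⟨ signℤ-involutive (n ∸ k) _ ⟩
    + stirling n k                                       ∎

open UnsignedStirling using (stirling; n<k⇒stirling≡0; stirling[1+n,0]≡0; stirling1≡stirling)

module CentralElements {a ℓ : Level} (R : Ring a ℓ) where
  open Ring R
  open import Relation.Binary.Reasoning.Setoid setoid
  open import Algebra.Properties.Ring R using (-‿distribˡ-*; -‿distribʳ-*)

  Central : Carrier → Set (a ⊔ ℓ)
  Central x = ∀ y → x * y ≈ y * x

  Central-resp-≈ : ∀ {x y} → x ≈ y → Central x → Central y
  Central-resp-≈ x≈y cx z = trans (*-cong (sym x≈y) refl) (trans (cx z) (*-cong refl x≈y))

  0#-central : Central 0#
  0#-central z = trans (zeroˡ z) (sym (zeroʳ z))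

  1#-central : Central 1#
  1#-central z = trans (*-identityˡ z) (sym (*-identityʳ z))

  +-central : ∀ {x y} → Central x → Central y → Central (x + y)
  +-central cx cy z = trans (distribʳ z _ _) (trans (+-cong (cx z) (cy z)) (sym (distribˡ z _ _)))

  -‿central : ∀ {x} → Central x → Central (- x)
  -‿central cx z = trans (sym (-‿distribˡ-* _ z)) (trans (-‿cong (cx z)) (-‿distribʳ-* z _))

  *-central : ∀ {x y} → Central x → Central y → Central (x * y)
  *-central {x} {y} cx cy z = begin
    x * y * z   ≈⟨ *-assoc x y z ⟩
    x * (y * z) ≈⟨ *-cong refl (cy z) ⟩
    x * (z * y) ≈⟨ *-assoc x z y ⟨
    x * z * y   ≈⟨ *-cong (cx z) refl ⟩
    z * x * y   ≈⟨ *-assoc z x y ⟩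
    z * (x * y) ∎

  central-swap : ∀ {c} → Central c → ∀ x y → x * (c * y) ≈ c * (x * y)
  central-swap {c} cc x y = begin
    x * (c * y) ≈⟨ *-assoc x c y ⟨
    x * c * y   ≈⟨ *-cong (sym (cc x)) refl ⟩
    c * x * y   ≈⟨ *-assoc c x y ⟩
    c * (x * y) ∎

module _ {c ℓ a ℓa : Level} (K : CommutativeRing c ℓ) (F : IsFieldChar0 K) (𝒜 : Algebra K a ℓa) where
  open Ops K F 𝒜
  private module K = CommutativeRing K
  open IsFieldChar0 F
  open Algebra 𝒜 using (ι; ι-cong; ι-+; ι-*; ι-1; central; algRing)
  open Ring algRing hiding (zero)
  open import Relation.Binary.Reasoning.Setoid setoid
  open import Algebra.Properties.Ring algRing
    using (-‿distribˡ-*; -‿distribʳ-*; x+x≈x⇒x≈0; -‿involutive; -‿anti-homo-+; -‿+-comm; -0#≈0#; x[y-z]≈xy-xz; [y-z]x≈yx-zx; -1*x≈-x)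
  open import Algebra.Properties.AbelianGroup +-abelianGroup using (∙-cancelˡ; ⁻¹-anti-homo‿-)
  open import Algebra.Solver.CommutativeMonoid +-commutativeMonoid using (solve; _⊕_; _⊜_)
  open CentralElements algRing

  sumTo-cong-≤ : ∀ n {f g : ℕ → Carrier} → (∀ i → i ≤ n → f i ≈ g i) → sumTo n f ≈ sumTo n g
  sumTo-cong-≤ zero    f≈g = f≈g 0 z≤n
  sumTo-cong-≤ (suc n) f≈g = +-cong (sumTo-cong-≤ n (λ i i≤n → f≈g i (ℕₚ.m≤n⇒m≤1+n i≤n))) (f≈g (suc n) ℕₚ.≤-refl)

  sumTo-cong : ∀ n {f g : ℕ → Carrier} → (∀ i → f i ≈ g i) → sumTo n f ≈ sumTo n g
  sumTo-cong n f≈g = sumTo-cong-≤ n (λ i _ → f≈g i)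

  sumTo-≈0 : ∀ n {f : ℕ → Carrier} → (∀ i → i ≤ n → f i ≈ 0#) → sumTo n f ≈ 0#
  sumTo-≈0 zero    f≈0 = f≈0 0 z≤n
  sumTo-≈0 (suc n) f≈0 = trans (+-cong (sumTo-≈0 n (λ i i≤n → f≈0 i (ℕₚ.m≤n⇒m≤1+n i≤n))) (f≈0 (suc n) ℕₚ.≤-refl)) (+-identityʳ 0#)

  sumTo-suc-head : ∀ n (f : ℕ → Carrier) → sumTo (suc n) f ≈ f 0 + sumTo n (λ i → f (suc i))
  sumTo-suc-head zero    f = refl
  sumTo-suc-head (suc n) f = trans (+-cong (sumTo-suc-head n f) refl) (+-assoc _ _ _)

  sumTo-distrib-+ : ∀ n (f g : ℕ → Carrier) → sumTo n (λ i → f i + g i) ≈ sumTo n f + sumTo n g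
  sumTo-distrib-+ zero    f g = refl
  sumTo-distrib-+ (suc n) f g = begin
    sumTo n (λ i → f i + g i) + (f (suc n) + g (suc n)) ≈⟨ +-cong (sumTo-distrib-+ n f g) refl ⟩
    (sumTo n f + sumTo n g) + (f (suc n) + g (suc n))   ≈⟨ solve 4 (λ a b x y → (a ⊕ b) ⊕ (x ⊕ y) ⊜ (a ⊕ x) ⊕ (b ⊕ y)) refl _ _ _ _ ⟩
    (sumTo n f + f (suc n)) + (sumTo n g + g (suc n))   ∎

  *-distribˡ-sumTo : ∀ n x (f : ℕ → Carrier) → x * sumTo n f ≈ sumTo n (λ i → x * f i)
  *-distribˡ-sumTo zero    x f = refl
  *-distribˡ-sumTo (suc n) x f = trans (distribˡ x _ _) (+-cong (*-distribˡ-sumTo n x f) refl)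

  *-distribʳ-sumTo : ∀ n x (f : ℕ → Carrier) → sumTo n f * x ≈ sumTo n (λ i → f i * x)
  *-distribʳ-sumTo zero    x f = refl
  *-distribʳ-sumTo (suc n) x f = trans (distribʳ x _ _) (+-cong (*-distribʳ-sumTo n x f) refl)

  sumTo-distrib-- : ∀ n (f g : ℕ → Carrier) → sumTo n (λ i → f i - g i) ≈ sumTo n f - sumTo n g
  sumTo-distrib-- n f g = begin
    sumTo n (λ i → f i - g i)          ≈⟨ sumTo-distrib-+ n f (λ i → - g i) ⟩
    sumTo n f + sumTo n (λ i → - g i)  ≈⟨ +-cong refl (sumTo-cong n (λ i → -1*x≈-x (g i))) ⟨
    sumTo n f + sumTo n (λ i → - 1# * g i) ≈⟨ +-cong refl (*-distribˡ-sumTo n (- 1#) g) ⟨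
    sumTo n f + - 1# * sumTo n g       ≈⟨ +-cong refl (-1*x≈-x _) ⟩
    sumTo n f - sumTo n g              ∎

  ι-central : ∀ k → Central (ι k)
  ι-central = central

  ι-0 : ι K.0# ≈ 0#
  ι-0 = x+x≈x⇒x≈0 _ (trans (sym (ι-+ _ _)) (ι-cong (K.+-identityˡ _)))

  ι-neg : ∀ x → ι (K.- x) ≈ - ι x
  ι-neg x = ∙-cancelˡ (ι x) _ _ (begin
    ι x + ι (K.- x) ≈⟨ ι-+ _ _ ⟨
    ι (x K.+ K.- x) ≈⟨ ι-cong (K.-‿inverseʳ x) ⟩
    ι K.0#          ≈⟨ ι-0 ⟩
    0#              ≈⟨ -‿inverseʳ _ ⟨
    ι x - ι x       ∎)

  ι-natK : ∀ n → ι (natK K n) ≈ natA n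
  ι-natK zero    = ι-0
  ι-natK (suc n) = trans (ι-+ _ _) (+-cong ι-1 (ι-natK n))

  natA-central : ∀ n → Central (natA n)
  natA-central zero    = 0#-central
  natA-central (suc n) = +-central 1#-central (natA-central n)

  natA-+ : ∀ m n → natA (m ℕ.+ n) ≈ natA m + natA n
  natA-+ zero    n = sym (+-identityˡ _)
  natA-+ (suc m) n = trans (+-cong refl (natA-+ m n)) (sym (+-assoc _ _ _))

  natA-* : ∀ m n → natA (m ℕ.* n) ≈ natA m * natA n
  natA-* zero    n = sym (zeroˡ _)
  natA-* (suc m) n = begin
    natA (n ℕ.+ m ℕ.* n)           ≈⟨ natA-+ n (m ℕ.* n) ⟩
    natA n + natA (m ℕ.* n)        ≈⟨ +-cong (sym (*-identityˡ _)) (natA-* m n) ⟩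
    1# * natA n + natA m * natA n  ≈⟨ distribʳ _ _ _ ⟨
    (1# + natA m) * natA n         ∎

  m≡0⇒natA*x*y≈0 : ∀ m → m ≡ 0 → ∀ x y → natA m * x * y ≈ 0#
  m≡0⇒natA*x*y≈0 m m≡0 x y = trans (*-cong (trans (*-cong (reflexive (P.cong natA m≡0)) refl) (zeroˡ x)) refl) (zeroˡ y)

  natA-1 : natA 1 ≈ 1#
  natA-1 = +-identityʳ 1#

  natA-suc : ∀ n x → natA (suc n) * x ≈ x + natA n * x
  natA-suc n x = trans (distribʳ x 1# (natA n)) (+-cong (*-identityˡ x) refl)

  pow-central : ∀ {x} → Central x → ∀ n → Central (pow x n)
  pow-central cx zero    = 1#-central
  pow-central cx (suc n) = *-central cx (pow-central cx n)

  pow-sucʳ : ∀ x n → pow x (suc n) ≈ pow x n * x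
  pow-sucʳ x zero    = trans (*-identityʳ _) (sym (*-identityˡ _))
  pow-sucʳ x (suc n) = trans (*-cong refl (pow-sucʳ x n)) (sym (*-assoc _ _ _))

  invSuc : ℕ → Carrier
  invSuc n = ι (inv (natK K (suc n)) (char0 n))

  invSuc*natA-suc : ∀ n → invSuc n * natA (suc n) ≈ 1#
  invSuc*natA-suc n = begin
    invSuc n * natA (suc n)                   ≈⟨ *-cong refl (ι-natK (suc n)) ⟨
    invSuc n * ι (natK K (suc n))             ≈⟨ ι-* _ _ ⟨
    ι (inv (natK K (suc n)) (char0 n) K.* natK K (suc n)) ≈⟨ ι-cong (K.trans (K.*-comm _ _) (inverse _ _)) ⟩
    ι K.1#                                    ≈⟨ ι-1 ⟩
    1#                                        ∎

  invFact-suc*natA-suc : ∀ n → ι (invFact (suc n)) * natA (suc n) ≈ ι (invFact n)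
  invFact-suc*natA-suc n = begin
    ι (invFact n K.* inv (natK K (suc n)) (char0 n)) * natA (suc n) ≈⟨ *-cong (ι-* _ _) refl ⟩
    ι (invFact n) * invSuc n * natA (suc n)         ≈⟨ *-assoc _ _ _ ⟩
    ι (invFact n) * (invSuc n * natA (suc n))       ≈⟨ *-cong refl (invSuc*natA-suc n) ⟩
    ι (invFact n) * 1#                              ≈⟨ *-identityʳ _ ⟩
    ι (invFact n)                                   ∎

  natA-suc*invFact-suc : ∀ n → natA (suc n) * ι (invFact (suc n)) ≈ ι (invFact n)
  natA-suc*invFact-suc n = trans (natA-central (suc n) _) (invFact-suc*natA-suc n)

  -- m/m! = 1/(m-1)!, so the weights shift the index by one.
  sumTo-invFact*natA-shift : ∀ n (x : ℕ → Carrier) → x (suc n) ≈ 0# →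
    sumTo n (λ m → ι (invFact m) * (natA m * x m)) ≈ sumTo n (λ m → ι (invFact m) * x (suc m))
  sumTo-invFact*natA-shift n x x[1+n]≈0 = begin
    sumTo n h                                         ≈⟨ +-identityʳ _ ⟨
    sumTo n h + 0#                                    ≈⟨ +-cong refl h[1+n]≈0 ⟨
    sumTo (suc n) h                                   ≈⟨ sumTo-suc-head n h ⟩
    h 0 + sumTo n (λ m → h (suc m))                   ≈⟨ +-cong h0≈0 (sumTo-cong n h[1+m]≈) ⟩
    0# + sumTo n (λ m → ι (invFact m) * x (suc m))    ≈⟨ +-identityˡ _ ⟩
    sumTo n (λ m → ι (invFact m) * x (suc m))         ∎
    where
      h : ℕ → Carrier
      h m = ι (invFact m) * (natA m * x m)
      h[1+n]≈0 : h (suc n) ≈ 0#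
      h[1+n]≈0 = trans (*-cong refl (trans (*-cong refl x[1+n]≈0) (zeroʳ _))) (zeroʳ _)
      h0≈0 : h 0 ≈ 0#
      h0≈0 = trans (*-cong refl (zeroˡ _)) (zeroʳ _)
      h[1+m]≈ : ∀ m → h (suc m) ≈ ι (invFact m) * x (suc m)
      h[1+m]≈ m = trans (sym (*-assoc _ _ _)) (*-cong (invFact-suc*natA-suc m) refl)

  x≈y+z⇒x-y≈z : ∀ {x y z} → x ≈ y + z → x - y ≈ z
  x≈y+z⇒x-y≈z {x} {y} {z} eq = begin
    x - y         ≈⟨ +-cong eq refl ⟩
    (y + z) - y   ≈⟨ solve 3 (λ p q r → (p ⊕ q) ⊕ r ⊜ q ⊕ (p ⊕ r)) refl y z (- y) ⟩
    z + (y - y)   ≈⟨ +-cong refl (-‿inverseʳ y) ⟩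
    z + 0#        ≈⟨ +-identityʳ z ⟩
    z             ∎

  x-y≈z⇒x≈y+z : ∀ {x y z} → x - y ≈ z → x ≈ y + z
  x-y≈z⇒x≈y+z {x} {y} {z} eq = begin
    x             ≈⟨ +-identityʳ x ⟨
    x + 0#        ≈⟨ +-cong refl (-‿inverseˡ y) ⟨
    x + (- y + y) ≈⟨ solve 3 (λ p q r → p ⊕ (q ⊕ r) ⊜ r ⊕ (p ⊕ q)) refl x (- y) y ⟩
    y + (x - y)   ≈⟨ +-cong refl eq ⟩
    y + z         ∎

  [,]-self : ∀ x → [ x , x ] ≈ 0#
  [,]-self x = -‿inverseʳ (x * x)

  [,]-anticomm : ∀ x y → [ x , y ] ≈ - [ y , x ]
  [,]-anticomm x y = begin
    x * y - y * x           ≈⟨ +-cong (-‿involutive _) refl ⟨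
    - - (x * y) + - (y * x) ≈⟨ -‿anti-homo-+ _ _ ⟨
    - (y * x - x * y)       ∎

  [,]-distribˡ-+ : ∀ x y z → [ x , y + z ] ≈ [ x , y ] + [ x , z ]
  [,]-distribˡ-+ x y z = begin
    x * (y + z) - (y + z) * x              ≈⟨ +-cong (distribˡ x y z) (-‿cong (distribʳ x y z)) ⟩
    (x * y + x * z) - (y * x + z * x)      ≈⟨ +-cong refl (-‿anti-homo-+ _ _) ⟩
    (x * y + x * z) + (- (z * x) + - (y * x))
      ≈⟨ solve 4 (λ p q r s → (p ⊕ q) ⊕ (r ⊕ s) ⊜ (p ⊕ s) ⊕ (q ⊕ r)) refl _ _ _ _ ⟩
    [ x , y ] + [ x , z ]                  ∎

  -- Formal power series

  D : Series → Series
  D f n = natA (suc n) * f (suc n)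

  D-cong : ∀ {f g} → f ≈S g → D f ≈S D g
  D-cong f≈g n = *-cong refl (f≈g (suc n))

  D-oneS : ∀ n → D oneS n ≈ 0#
  D-oneS n = zeroʳ _

  D-*S : ∀ (f g : Series) n → D (f *S g) n ≈ (D f *S g) n + (f *S D g) n
  D-*S f g n = begin
    natA (suc n) * sumTo (suc n) (λ i → f i * g (suc n ∸ i))         ≈⟨ *-distribˡ-sumTo (suc n) _ _ ⟩
    sumTo (suc n) (λ i → natA (suc n) * (f i * g (suc n ∸ i)))       ≈⟨ sumTo-cong-≤ (suc n) split ⟩
    sumTo (suc n) (λ i → l i + r i)                                  ≈⟨ sumTo-distrib-+ (suc n) l r ⟩
    sumTo (suc n) l + sumTo (suc n) r                                ≈⟨ +-cong (sumTo-suc-head n l) refl ⟩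
    (l 0 + sumTo n (λ i → l (suc i))) + (sumTo n r + r (suc n))      ≈⟨ +-cong (+-cong l0≈0 refl) (+-cong (sumTo-cong-≤ n r≈) r[1+n]≈0) ⟩
    (0# + (D f *S g) n) + ((f *S D g) n + 0#)                        ≈⟨ +-cong (+-identityˡ _) (+-identityʳ _) ⟩
    (D f *S g) n + (f *S D g) n                                      ∎
    where
      l r : ℕ → Carrier
      l i = natA i * f i * g (suc n ∸ i)
      r i = f i * (natA (suc n ∸ i) * g (suc n ∸ i))
      split : ∀ i → i ≤ suc n → natA (suc n) * (f i * g (suc n ∸ i)) ≈ l i + r i
      split i i≤1+n = begin
        natA (suc n) * (f i * g (suc n ∸ i))                ≈⟨ *-cong (reflexive (P.cong natA (ℕₚ.m+[n∸m]≡n i≤1+n))) refl ⟨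
        natA (i ℕ.+ (suc n ∸ i)) * (f i * g (suc n ∸ i))    ≈⟨ trans (*-cong (natA-+ i _) refl) (distribʳ _ _ _) ⟩
        natA i * (f i * g (suc n ∸ i)) + natA (suc n ∸ i) * (f i * g (suc n ∸ i))
          ≈⟨ +-cong (sym (*-assoc _ _ _)) (sym (central-swap (natA-central (suc n ∸ i)) _ _)) ⟩
        l i + r i                                            ∎
      l0≈0 : l 0 ≈ 0#
      l0≈0 = trans (*-cong (zeroˡ _) refl) (zeroˡ _)
      r[1+n]≈0 : r (suc n) ≈ 0#
      r[1+n]≈0 = trans (*-cong refl (trans (*-cong (reflexive (P.cong natA (ℕₚ.n∸n≡0 n))) refl) (zeroˡ _))) (zeroʳ _)
      r≈ : ∀ i → i ≤ n → r i ≈ f i * D g (n ∸ i)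
      r≈ i i≤n = reflexive (P.cong (λ k → f i * (natA k * g k)) (ℕₚ.+-∸-assoc 1 i≤n))

  oneS-*S : ∀ (f : Series) → (oneS *S f) ≈S f
  oneS-*S f zero    = *-identityˡ _
  oneS-*S f (suc n) = begin
    sumTo (suc n) (λ i → oneS i * f (suc n ∸ i))       ≈⟨ sumTo-suc-head n _ ⟩
    1# * f (suc n) + sumTo n (λ i → 0# * f (n ∸ i))    ≈⟨ +-cong (*-identityˡ _) (sumTo-≈0 n (λ i _ → zeroˡ _)) ⟩
    f (suc n) + 0#                                     ≈⟨ +-identityʳ _ ⟩
    f (suc n)                                          ∎

  linT-*S-zero : ∀ X (f : Series) → (linT X *S f) 0 ≈ 0#
  linT-*S-zero X f = zeroˡ _

  linT-*S-suc : ∀ X (f : Series) n → (linT X *S f) (suc n) ≈ X * f n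
  linT-*S-suc X f zero    = trans (+-cong (zeroˡ _) refl) (+-identityˡ _)
  linT-*S-suc X f (suc n) = begin
    sumTo (suc (suc n)) (λ i → linT X i * f (suc (suc n) ∸ i))                            ≈⟨ sumTo-suc-head (suc n) _ ⟩
    0# * f (suc (suc n)) + sumTo (suc n) (λ i → linT X (suc i) * f (suc n ∸ i))           ≈⟨ +-cong (zeroˡ _) (sumTo-suc-head n _) ⟩
    0# + (X * f (suc n) + sumTo n (λ i → 0# * f (n ∸ i)))                                 ≈⟨ +-identityˡ _ ⟩
    X * f (suc n) + sumTo n (λ i → 0# * f (n ∸ i))                                        ≈⟨ +-cong refl (sumTo-≈0 n (λ i _ → zeroˡ _)) ⟩
    X * f (suc n) + 0#                                                                    ≈⟨ +-identityʳ _ ⟩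
    X * f (suc n)                                                                         ∎

  powS-linT-diagonal : ∀ X n → powS (linT X) n n ≈ pow X n
  powS-linT-diagonal X zero    = refl
  powS-linT-diagonal X (suc n) = trans (linT-*S-suc X (powS (linT X) n) n) (*-cong refl (powS-linT-diagonal X n))

  powS-linT-offDiagonal : ∀ X {m n} → m ≢ n → powS (linT X) m n ≈ 0#
  powS-linT-offDiagonal X {zero}  {zero}  m≢n = ⊥-elim (m≢n P.refl)
  powS-linT-offDiagonal X {zero}  {suc n} m≢n = refl
  powS-linT-offDiagonal X {suc m} {zero}  m≢n = linT-*S-zero X (powS (linT X) m)
  powS-linT-offDiagonal X {suc m} {suc n} m≢n =
    trans (linT-*S-suc X (powS (linT X) m) n) (trans (*-cong refl (powS-linT-offDiagonal X (m≢n ∘ P.cong suc))) (zeroʳ _))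

  expS-linT : ∀ X n → expS (linT X) n ≈ ι (invFact n) * pow X n
  expS-linT X zero    = *-cong refl (powS-linT-diagonal X 0)
  expS-linT X (suc n) = begin
    sumTo n (λ m → ι (invFact m) * powS (linT X) m (suc n)) + ι (invFact (suc n)) * powS (linT X) (suc n) (suc n)
      ≈⟨ +-cong (sumTo-≈0 n below) (*-cong refl (powS-linT-diagonal X (suc n))) ⟩
    0# + ι (invFact (suc n)) * pow X (suc n)  ≈⟨ +-identityˡ _ ⟩
    ι (invFact (suc n)) * pow X (suc n)       ∎
    where
      below : ∀ m → m ≤ n → ι (invFact m) * powS (linT X) m (suc n) ≈ 0#
      below m m≤n = trans (*-cong refl (powS-linT-offDiagonal X (ℕₚ.<⇒≢ (s≤s m≤n)))) (zeroʳ _)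

  D-expS-linTˡ : ∀ X n → D (expS (linT X)) n ≈ X * expS (linT X) n
  D-expS-linTˡ X n = begin
    natA (suc n) * expS (linT X) (suc n)                    ≈⟨ *-cong refl (expS-linT X (suc n)) ⟩
    natA (suc n) * (ι (invFact (suc n)) * (X * pow X n))    ≈⟨ *-assoc _ _ _ ⟨
    natA (suc n) * ι (invFact (suc n)) * (X * pow X n)      ≈⟨ *-cong (natA-suc*invFact-suc n) refl ⟩
    ι (invFact n) * (X * pow X n)                           ≈⟨ central-swap (ι-central _) _ _ ⟨
    X * (ι (invFact n) * pow X n)                           ≈⟨ *-cong refl (expS-linT X n) ⟨
    X * expS (linT X) n                                     ∎

  D-expS-linTʳ : ∀ X n → D (expS (linT X)) n ≈ expS (linT X) n * X
  D-expS-linTʳ X n = begin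
    natA (suc n) * expS (linT X) (suc n)                    ≈⟨ *-cong refl (expS-linT X (suc n)) ⟩
    natA (suc n) * (ι (invFact (suc n)) * pow X (suc n))    ≈⟨ *-assoc _ _ _ ⟨
    natA (suc n) * ι (invFact (suc n)) * pow X (suc n)      ≈⟨ *-cong (natA-suc*invFact-suc n) (pow-sucʳ X n) ⟩
    ι (invFact n) * (pow X n * X)                           ≈⟨ *-assoc _ _ _ ⟨
    ι (invFact n) * pow X n * X                             ≈⟨ *-cong (expS-linT X n) refl ⟨
    expS (linT X) n * X                                     ∎

  IsSolution : Carrier → Carrier → Series → Set ℓa
  IsSolution A B f = ∀ n → D f n ≈ A * f n + f n * B

  -- D f n determines f (n+1) because n+1 is invertible.
  IsSolution-unique : ∀ {A B} {f g : Series} → f 0 ≈ g 0 → IsSolution A B f → IsSolution A B g → f ≈S g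
  IsSolution-unique f0≈g0 sf sg zero    = f0≈g0
  IsSolution-unique {A} {B} {f} {g} f0≈g0 sf sg (suc n) = begin
    f (suc n)                          ≈⟨ *-identityˡ _ ⟨
    1# * f (suc n)                     ≈⟨ *-cong (invSuc*natA-suc n) refl ⟨
    invSuc n * natA (suc n) * f (suc n) ≈⟨ *-assoc _ _ _ ⟩
    invSuc n * D f n                   ≈⟨ *-cong refl (sf n) ⟩
    invSuc n * (A * f n + f n * B)     ≈⟨ *-cong refl (+-cong (*-cong refl fn≈gn) (*-cong fn≈gn refl)) ⟩
    invSuc n * (A * g n + g n * B)     ≈⟨ *-cong refl (sg n) ⟨
    invSuc n * D g n                   ≈⟨ *-assoc _ _ _ ⟨
    invSuc n * natA (suc n) * g (suc n) ≈⟨ *-cong (invSuc*natA-suc n) refl ⟩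
    1# * g (suc n)                     ≈⟨ *-identityˡ _ ⟩
    g (suc n)                          ∎
    where
      fn≈gn : f n ≈ g n
      fn≈gn = IsSolution-unique f0≈g0 sf sg n

  expProduct : Carrier → Carrier → Series
  expProduct A B = expS (linT A) *S expS (linT B)

  expS-zero : ∀ f → expS f 0 ≈ 1#
  expS-zero f = trans (*-cong ι-1 refl) (*-identityˡ _)

  expProduct-zero : ∀ A B → expProduct A B 0 ≈ 1#
  expProduct-zero A B = trans (*-cong (expS-zero (linT A)) (expS-zero (linT B))) (*-identityˡ _)

  expProduct-isSolution : ∀ A B → IsSolution A B (expProduct A B)
  expProduct-isSolution A B n = begin
    D (EA *S EB) n                                          ≈⟨ D-*S EA EB n ⟩
    (D EA *S EB) n + (EA *S D EB) n
      ≈⟨ +-cong (sumTo-cong n (λ i → *-cong (D-expS-linTˡ A i) refl)) (sumTo-cong n (λ i → *-cong refl (D-expS-linTʳ B (n ∸ i)))) ⟩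
    sumTo n (λ i → A * EA i * EB (n ∸ i)) + sumTo n (λ i → EA i * (EB (n ∸ i) * B))
      ≈⟨ +-cong (sumTo-cong n (λ i → *-assoc _ _ _)) (sumTo-cong n (λ i → sym (*-assoc _ _ _))) ⟩
    sumTo n (λ i → A * (EA i * EB (n ∸ i))) + sumTo n (λ i → EA i * EB (n ∸ i) * B)
      ≈⟨ +-cong (*-distribˡ-sumTo n A _) (*-distribʳ-sumTo n B _) ⟨
    A * (EA *S EB) n + (EA *S EB) n * B                     ∎
    where
      EA EB : Series
      EA = expS (linT A)
      EB = expS (linT B)

  module _ (A B : Carrier) where

    [B,A+B]≈[B,A] : [ B , A + B ] ≈ [ B , A ]
    [B,A+B]≈[B,A] = trans ([,]-distribˡ-+ B A B) (trans (+-cong refl ([,]-self B)) (+-identityʳ _))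

    [A,A+B]≈-[B,A] : [ A , A + B ] ≈ - [ B , A ]
    [A,A+B]≈-[B,A] = trans ([,]-distribˡ-+ A A B) (trans (+-cong ([,]-self A) refl) (trans (+-identityˡ _) ([,]-anticomm A B)))

    -- The Stirling expansion of (A + B)^n

    binomialSum : ℕ → Carrier
    binomialSum k = sumTo k (λ j → natA (k C j) * pow A j * pow B (k ∸ j))

    A*binomialSum : ∀ k → A * binomialSum k ≈ sumTo k (λ j → natA (k C j) * pow A (suc j) * pow B (k ∸ j))
    A*binomialSum k = trans (*-distribˡ-sumTo k A _) (sumTo-cong k (λ j → begin
      A * (natA (k C j) * pow A j * pow B (k ∸ j))   ≈⟨ *-assoc _ _ _ ⟨
      A * (natA (k C j) * pow A j) * pow B (k ∸ j)   ≈⟨ *-cong (central-swap (natA-central (k C j)) A (pow A j)) refl ⟩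
      natA (k C j) * pow A (suc j) * pow B (k ∸ j)   ∎))

    binomialSum*B : ∀ k → binomialSum k * B ≈ sumTo (suc k) (λ j → natA (k C j) * pow A j * pow B (suc k ∸ j))
    binomialSum*B k = begin
      binomialSum k * B                          ≈⟨ *-distribʳ-sumTo k B _ ⟩
      sumTo k (λ j → t j * B)                    ≈⟨ sumTo-cong-≤ k t*B≈ ⟩
      sumTo k t′                                 ≈⟨ +-identityʳ _ ⟨
      sumTo k t′ + 0#                            ≈⟨ +-cong refl t′[1+k]≈0 ⟨
      sumTo (suc k) t′                           ∎
      where
        t t′ : ℕ → Carrier
        t  j = natA (k C j) * pow A j * pow B (k ∸ j)
        t′ j = natA (k C j) * pow A j * pow B (suc k ∸ j)
        t*B≈ : ∀ j → j ≤ k → t j * B ≈ t′ j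
        t*B≈ j j≤k = begin
          natA (k C j) * pow A j * pow B (k ∸ j) * B    ≈⟨ *-assoc _ _ _ ⟩
          natA (k C j) * pow A j * (pow B (k ∸ j) * B)  ≈⟨ *-cong refl (pow-sucʳ B (k ∸ j)) ⟨
          natA (k C j) * pow A j * pow B (suc (k ∸ j))  ≈⟨ *-cong refl (reflexive (P.cong (pow B) (ℕₚ.+-∸-assoc 1 j≤k))) ⟨
          t′ j                                          ∎
        t′[1+k]≈0 : t′ (suc k) ≈ 0#
        t′[1+k]≈0 = m≡0⇒natA*x*y≈0 (k C suc k) (k>n⇒nCk≡0 (ℕₚ.n<1+n k)) _ _

    -- Pascal's rule holds without commutativity, since C(k+1,j+1) = C(k,j) + C(k,j+1)
    -- splits each term into one with a leading A and one with a trailing B.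
    binomialSum-suc : ∀ k → binomialSum (suc k) ≈ A * binomialSum k + binomialSum k * B
    binomialSum-suc k = begin
      binomialSum (suc k)                                     ≈⟨ sumTo-suc-head k _ ⟩
      t′ 0 + sumTo k (λ j → natA (suc k C suc j) * pow A (suc j) * pow B (k ∸ j))
        ≈⟨ +-cong refl (sumTo-cong k pascal) ⟩
      t′ 0 + sumTo k (λ j → l j + r j)                        ≈⟨ +-cong refl (sumTo-distrib-+ k l r) ⟩
      t′ 0 + (sumTo k l + sumTo k r)                          ≈⟨ solve 3 (λ x y z → x ⊕ (y ⊕ z) ⊜ y ⊕ (x ⊕ z)) refl _ _ _ ⟩
      sumTo k l + (t′ 0 + sumTo k r)                          ≈⟨ +-cong (sym (A*binomialSum k)) (sym (sumTo-suc-head k t′)) ⟩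
      A * binomialSum k + sumTo (suc k) t′                    ≈⟨ +-cong refl (binomialSum*B k) ⟨
      A * binomialSum k + binomialSum k * B                   ∎
      where
        l r t′ : ℕ → Carrier
        l j = natA (k C j) * pow A (suc j) * pow B (k ∸ j)
        r j = natA (k C suc j) * pow A (suc j) * pow B (k ∸ j)
        t′ j = natA (k C j) * pow A j * pow B (suc k ∸ j)
        pascal : ∀ j → natA (suc k C suc j) * pow A (suc j) * pow B (k ∸ j) ≈ l j + r j
        pascal j = begin
          natA (suc k C suc j) * pow A (suc j) * pow B (k ∸ j)
            ≈⟨ *-cong (*-cong (reflexive (P.cong natA (nCk+nC[k+1]≡[n+1]C[k+1] k j))) refl) refl ⟨
          natA (k C j ℕ.+ k C suc j) * pow A (suc j) * pow B (k ∸ j)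
            ≈⟨ *-cong (*-cong (natA-+ (k C j) _) refl) refl ⟩
          (natA (k C j) + natA (k C suc j)) * pow A (suc j) * pow B (k ∸ j)
            ≈⟨ trans (*-cong (distribʳ _ _ _) refl) (distribʳ _ _ _) ⟩
          l j + r j ∎

    module _ (ε : K.Carrier) where

      stirlingCoeff : ℕ → ℕ → Carrier
      stirlingCoeff n k = natA (stirling n k) * ι (powK ε (n ∸ k))

      stirlingCoeff-central : ∀ n k → Central (stirlingCoeff n k)
      stirlingCoeff-central n k = *-central (natA-central (stirling n k)) (ι-central _)

      stirlingSum : ℕ → Carrier
      stirlingSum n = sumTo n (λ k → stirlingCoeff n k * binomialSum k)

      stirlingSum-zero : stirlingSum 0 ≈ 1#
      stirlingSum-zero = trans (*-cong (trans (*-cong natA-1 ι-1) (*-identityˡ 1#)) (trans (*-cong (*-cong natA-1 refl) refl) (trans (*-identityʳ _) (*-identityˡ _))))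
                               (*-identityˡ 1#)

      stirling1Sum≈stirlingSum : ∀ n → sumTo n (λ k → intA (stirling1 n k) * ι (powK ε (n ∸ k)) * binomialSum k) ≈ stirlingSum n
      stirling1Sum≈stirlingSum n = sumTo-cong n (λ k → reflexive (P.cong (λ s → intA s * ι (powK ε (n ∸ k)) * binomialSum k) (stirling1≡stirling n k)))

      stirlingCoeff-suc : ∀ n k → stirlingCoeff (suc n) (suc k)
                          ≈ stirlingCoeff n k + natA n * (natA (stirling n (suc k)) * ι (powK ε (n ∸ k)))
      stirlingCoeff-suc n k = begin
        natA (stirling n k ℕ.+ n ℕ.* stirling n (suc k)) * e                ≈⟨ *-cong (natA-+ (stirling n k) _) refl ⟩
        (natA (stirling n k) + natA (n ℕ.* stirling n (suc k))) * e          ≈⟨ *-cong (+-cong refl (natA-* n _)) refl ⟩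
        (natA (stirling n k) + natA n * natA (stirling n (suc k))) * e       ≈⟨ distribʳ _ _ _ ⟩
        stirlingCoeff n k + natA n * natA (stirling n (suc k)) * e          ≈⟨ +-cong refl (*-assoc _ _ _) ⟩
        stirlingCoeff n k + natA n * (natA (stirling n (suc k)) * e)        ∎
        where
          e : Carrier
          e = ι (powK ε (n ∸ k))

      -- Each term carries one more factor ε than the k+1 term of stirlingSum n.
      raisedStirlingSum : ℕ → Carrier
      raisedStirlingSum n = sumTo n (λ k → natA (stirling n (suc k)) * ι (powK ε (n ∸ k)) * binomialSum (suc k))

      raisedStirlingSum-suc : ∀ m → raisedStirlingSum (suc m) ≈ ι ε * stirlingSum (suc m)
      raisedStirlingSum-suc m = begin
        sumTo m q + q (suc m)                                        ≈⟨ +-cong (sumTo-cong-≤ m q≈) q[1+m]≈0 ⟩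
        sumTo m (λ k → ι ε * (coeff (suc k) * binomialSum (suc k))) + 0# ≈⟨ +-identityʳ _ ⟩
        sumTo m (λ k → ι ε * (coeff (suc k) * binomialSum (suc k)))      ≈⟨ +-identityˡ _ ⟨
        0# + sumTo m (λ k → ι ε * (coeff (suc k) * binomialSum (suc k))) ≈⟨ +-cong head≈0 refl ⟨
        ι ε * (coeff 0 * binomialSum 0) + sumTo m (λ k → ι ε * (coeff (suc k) * binomialSum (suc k))) ≈⟨ sumTo-suc-head m _ ⟨
        sumTo (suc m) (λ k → ι ε * (coeff k * binomialSum k))            ≈⟨ *-distribˡ-sumTo (suc m) _ _ ⟨
        ι ε * stirlingSum (suc m)                                    ∎
        where
          coeff : ℕ → Carrier
          coeff = stirlingCoeff (suc m)
          q : ℕ → Carrier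
          q k = natA (stirling (suc m) (suc k)) * ι (powK ε (suc m ∸ k)) * binomialSum (suc k)
          q[1+m]≈0 : q (suc m) ≈ 0#
          q[1+m]≈0 = m≡0⇒natA*x*y≈0 (stirling (suc m) (suc (suc m))) (n<k⇒stirling≡0 (ℕₚ.n<1+n (suc m))) _ _
          head≈0 : ι ε * (coeff 0 * binomialSum 0) ≈ 0#
          head≈0 = trans (*-cong refl (m≡0⇒natA*x*y≈0 (stirling (suc m) 0) (stirling[1+n,0]≡0 m) _ _)) (zeroʳ _)
          q≈ : ∀ k → k ≤ m → q k ≈ ι ε * (coeff (suc k) * binomialSum (suc k))
          q≈ k k≤m = begin
            natA s * ι (powK ε (suc m ∸ k)) * N            ≈⟨ *-cong (*-cong refl (reflexive (P.cong (ι ∘ powK ε) (ℕₚ.+-∸-assoc 1 k≤m)))) refl ⟩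
            natA s * ι (ε K.* powK ε (m ∸ k)) * N          ≈⟨ *-cong (*-cong refl (ι-* _ _)) refl ⟩
            natA s * (ι ε * ι (powK ε (m ∸ k))) * N        ≈⟨ *-cong (central-swap (ι-central ε) _ _) refl ⟩
            ι ε * coeff (suc k) * N                            ≈⟨ *-assoc _ _ _ ⟩
            ι ε * (coeff (suc k) * N)                          ∎
            where
              s : ℕ
              s = stirling (suc m) (suc k)
              N : Carrier
              N = binomialSum (suc k)

      stirlingSum-suc : ∀ n → stirlingSum (suc n) ≈ A * stirlingSum n + stirlingSum n * B + natA n * (ι ε * stirlingSum n)
      stirlingSum-suc n = begin
        stirlingSum (suc n)                                                          ≈⟨ sumTo-suc-head n _ ⟩
        stirlingCoeff (suc n) 0 * binomialSum 0 + sumTo n (λ k → stirlingCoeff (suc n) (suc k) * binomialSum (suc k))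
          ≈⟨ +-cong head≈0 (sumTo-cong n split) ⟩
        0# + sumTo n (λ k → stirlingCoeff n k * binomialSum (suc k) + natA n * r k) ≈⟨ +-identityˡ _ ⟩
        sumTo n (λ k → stirlingCoeff n k * binomialSum (suc k) + natA n * r k)      ≈⟨ sumTo-distrib-+ n _ _ ⟩
        sumTo n (λ k → stirlingCoeff n k * binomialSum (suc k)) + sumTo n (λ k → natA n * r k)
          ≈⟨ +-cong pascalPart (sym (*-distribˡ-sumTo n (natA n) r)) ⟩
        A * stirlingSum n + stirlingSum n * B + natA n * raisedStirlingSum n         ≈⟨ +-cong refl (raisedPart n) ⟩
        A * stirlingSum n + stirlingSum n * B + natA n * (ι ε * stirlingSum n)       ∎
        where
          r : ℕ → Carrier
          r k = natA (stirling n (suc k)) * ι (powK ε (n ∸ k)) * binomialSum (suc k)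
          head≈0 : stirlingCoeff (suc n) 0 * binomialSum 0 ≈ 0#
          head≈0 = m≡0⇒natA*x*y≈0 (stirling (suc n) 0) (stirling[1+n,0]≡0 n) _ _
          split : ∀ k → stirlingCoeff (suc n) (suc k) * binomialSum (suc k) ≈ stirlingCoeff n k * binomialSum (suc k) + natA n * r k
          split k = trans (*-cong (stirlingCoeff-suc n k) refl) (trans (distribʳ _ _ _) (+-cong refl (*-assoc _ _ _)))
          pascalPart : sumTo n (λ k → stirlingCoeff n k * binomialSum (suc k)) ≈ A * stirlingSum n + stirlingSum n * B
          pascalPart = begin
            sumTo n (λ k → stirlingCoeff n k * binomialSum (suc k))
              ≈⟨ sumTo-cong n (λ k → trans (*-cong refl (binomialSum-suc k)) (distribˡ _ _ _)) ⟩
            sumTo n (λ k → stirlingCoeff n k * (A * binomialSum k) + stirlingCoeff n k * (binomialSum k * B))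
              ≈⟨ sumTo-cong n (λ k → +-cong (sym (central-swap (stirlingCoeff-central n k) A _)) (sym (*-assoc _ _ _))) ⟩
            sumTo n (λ k → A * (stirlingCoeff n k * binomialSum k) + stirlingCoeff n k * binomialSum k * B)
              ≈⟨ sumTo-distrib-+ n _ _ ⟩
            sumTo n (λ k → A * (stirlingCoeff n k * binomialSum k)) + sumTo n (λ k → stirlingCoeff n k * binomialSum k * B)
              ≈⟨ +-cong (*-distribˡ-sumTo n A _) (*-distribʳ-sumTo n B _) ⟨
            A * stirlingSum n + stirlingSum n * B ∎
          raisedPart : ∀ n → natA n * raisedStirlingSum n ≈ natA n * (ι ε * stirlingSum n)
          raisedPart zero    = trans (zeroˡ _) (sym (zeroˡ _))
          raisedPart (suc m) = *-cong refl (raisedStirlingSum-suc m)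

      B*[A+B]⇒[B,A] : B * (A + B) ≈ (A + B) * B + ι ε * (A + B) → [ B , A ] ≈ ι ε * (A + B)
      B*[A+B]⇒[B,A] eq = trans (sym [B,A+B]≈[B,A]) (x≈y+z⇒x-y≈z eq)

      module _ ([B,A]≈ε[A+B] : [ B , A ] ≈ ι ε * (A + B)) where

        B*[A+B] : B * (A + B) ≈ (A + B) * B + ι ε * (A + B)
        B*[A+B] = x-y≈z⇒x≈y+z (trans [B,A+B]≈[B,A] [B,A]≈ε[A+B])

        A*[A+B] : A * (A + B) ≈ (A + B) * A - ι ε * (A + B)
        A*[A+B] = x-y≈z⇒x≈y+z (trans [A,A+B]≈-[B,A] (-‿cong [B,A]≈ε[A+B]))

        B*pow[A+B] : ∀ n → B * pow (A + B) n ≈ pow (A + B) n * B + natA n * (ι ε * pow (A + B) n)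
        B*pow[A+B] zero = begin
          B * 1#               ≈⟨ trans (*-identityʳ B) (sym (*-identityˡ B)) ⟩
          1# * B               ≈⟨ +-identityʳ _ ⟨
          1# * B + 0#          ≈⟨ +-cong refl (zeroˡ _) ⟨
          1# * B + 0# * (ι ε * 1#) ∎
        B*pow[A+B] (suc n) = begin
          B * (S * X)                                     ≈⟨ *-assoc _ _ _ ⟨
          B * S * X                                       ≈⟨ *-cong B*[A+B] refl ⟩
          (S * B + ι ε * S) * X                           ≈⟨ distribʳ _ _ _ ⟩
          S * B * X + ι ε * S * X                         ≈⟨ +-cong (*-assoc _ _ _) (*-assoc _ _ _) ⟩
          S * (B * X) + ι ε * (S * X)                     ≈⟨ +-cong (*-cong refl (B*pow[A+B] n)) refl ⟩
          S * (X * B + natA n * (ι ε * X)) + ι ε * (S * X) ≈⟨ +-cong (distribˡ _ _ _) refl ⟩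
          (S * (X * B) + S * (natA n * (ι ε * X))) + ι ε * (S * X)
            ≈⟨ +-cong (+-cong (sym (*-assoc _ _ _)) (trans (central-swap (natA-central n) S _) (*-cong refl (central-swap (ι-central ε) S X)))) refl ⟩
          (S * X * B + natA n * (ι ε * (S * X))) + ι ε * (S * X) ≈⟨ +-assoc _ _ _ ⟩
          S * X * B + (natA n * (ι ε * (S * X)) + ι ε * (S * X)) ≈⟨ +-cong refl (+-comm _ _) ⟩
          S * X * B + (ι ε * (S * X) + natA n * (ι ε * (S * X))) ≈⟨ +-cong refl (natA-suc n _) ⟨
          S * X * B + natA (suc n) * (ι ε * (S * X))        ∎
          where
            S X : Carrier
            S = A + B
            X = pow (A + B) n

        pow[A+B]≈stirlingSum : ∀ n → pow (A + B) n ≈ stirlingSum n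
        pow[A+B]≈stirlingSum zero    = sym stirlingSum-zero
        pow[A+B]≈stirlingSum (suc n) = begin
          (A + B) * X                                      ≈⟨ distribʳ _ _ _ ⟩
          A * X + B * X                                    ≈⟨ +-cong refl (B*pow[A+B] n) ⟩
          A * X + (X * B + natA n * (ι ε * X))             ≈⟨ +-assoc _ _ _ ⟨
          A * X + X * B + natA n * (ι ε * X)
            ≈⟨ +-cong (+-cong (*-cong refl ih) (*-cong ih refl)) (*-cong refl (*-cong refl ih)) ⟩
          A * M + M * B + natA n * (ι ε * M)               ≈⟨ stirlingSum-suc n ⟨
          stirlingSum (suc n)                              ∎
          where
            X M : Carrier
            X = pow (A + B) n
            M = stirlingSum n
            ih : X ≈ M
            ih = pow[A+B]≈stirlingSum n

      stirlingSum-one : stirlingSum 1 ≈ A + B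
      stirlingSum-one = begin
        stirlingSum 1                                                          ≈⟨ stirlingSum-suc 0 ⟩
        A * stirlingSum 0 + stirlingSum 0 * B + 0# * (ι ε * stirlingSum 0)     ≈⟨ +-cong refl (zeroˡ _) ⟩
        A * stirlingSum 0 + stirlingSum 0 * B + 0#                             ≈⟨ +-identityʳ _ ⟩
        A * stirlingSum 0 + stirlingSum 0 * B                                  ≈⟨ +-cong (*-cong refl stirlingSum-zero) (*-cong stirlingSum-zero refl) ⟩
        A * 1# + 1# * B                                                        ≈⟨ +-cong (*-identityʳ A) (*-identityˡ B) ⟩
        A + B                                                                  ∎

      pow[A+B]≈stirlingSum⇒[B,A] : (∀ n → pow (A + B) n ≈ stirlingSum n) → [ B , A ] ≈ ι ε * (A + B)
      pow[A+B]≈stirlingSum⇒[B,A] eq = B*[A+B]⇒[B,A] (∙-cancelˡ (A * S) _ _ (begin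
        A * S + B * S                           ≈⟨ distribʳ _ _ _ ⟨
        S * S                                   ≈⟨ *-cong refl (*-identityʳ S) ⟨
        pow S 2                                 ≈⟨ eq 2 ⟩
        stirlingSum 2                           ≈⟨ stirlingSum-suc 1 ⟩
        A * stirlingSum 1 + stirlingSum 1 * B + natA 1 * (ι ε * stirlingSum 1)
          ≈⟨ +-cong (+-cong (*-cong refl stirlingSum-one) (*-cong stirlingSum-one refl)) (trans (*-cong natA-1 refl) (*-identityˡ _)) ⟩
        A * S + S * B + ι ε * stirlingSum 1     ≈⟨ +-cong refl (*-cong refl stirlingSum-one) ⟩
        A * S + S * B + ι ε * S                 ≈⟨ +-assoc _ _ _ ⟩
        A * S + (S * B + ι ε * S)               ∎))
        where
          S : Carrier
          S = A + B

      -- The exponential identity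

      module _ (ε≉0 : ¬ (ε K.≈ K.0#)) where

        ε⁻¹ : K.Carrier
        ε⁻¹ = inv ε ε≉0

        ιε*ιε⁻¹ : ι ε * ι ε⁻¹ ≈ 1#
        ιε*ιε⁻¹ = trans (sym (ι-* _ _)) (trans (ι-cong (inverse ε ε≉0)) ι-1)

        ιε⁻¹*ιε : ι ε⁻¹ * ι ε ≈ 1#
        ιε⁻¹*ιε = trans (ι-central _ _) ιε*ιε⁻¹

        ιε*[ιε⁻¹*x] : ∀ x → ι ε * (ι ε⁻¹ * x) ≈ x
        ιε*[ιε⁻¹*x] x = trans (sym (*-assoc _ _ _)) (trans (*-cong ιε*ιε⁻¹ refl) (*-identityˡ x))

        ιε⁻¹*[ιε*x] : ∀ x → ι ε⁻¹ * (ι ε * x) ≈ x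
        ιε⁻¹*[ιε*x] x = trans (sym (*-assoc _ _ _)) (trans (*-cong ιε⁻¹*ιε refl) (*-identityˡ x))

        S : Carrier
        S = A + B

        -- e^(-εt), and v = (A+B)(1 - e^(-εt))/ε, whose exponential G is the right-hand side of (iii).
        E v G : Series
        E = expS (linT (ι (K.- ε)))
        v = S ·S shiftT A B ε ε≉0
        G = expS v

        V : ℕ → Series
        V = powS v

        E-central : ∀ n → Central (E n)
        E-central n = Central-resp-≈ (sym (expS-linT _ n)) (*-central (ι-central _) (pow-central (ι-central _) n))

        oneS-central : ∀ n → Central (oneS n)
        oneS-central zero    = 1#-central
        oneS-central (suc n) = 0#-central

        shiftT-central : ∀ n → Central (shiftT A B ε ε≉0 n)
        shiftT-central n = *-central (ι-central _) (+-central (oneS-central n) (-‿central (E-central n)))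

        v*[S*y] : ∀ i y → v i * (S * y) ≈ S * (v i * y)
        v*[S*y] i y = begin
          S * u * (S * y)  ≈⟨ *-assoc _ _ _ ⟩
          S * (u * (S * y)) ≈⟨ *-cong refl (central-swap (shiftT-central i) S y) ⟨
          S * (S * (u * y)) ≈⟨ *-cong refl (*-assoc _ _ _) ⟨
          S * (S * u * y)  ∎
          where
            u : Carrier
            u = shiftT A B ε ε≉0 i

        v-zero : v 0 ≈ 0#
        v-zero = trans (*-cong refl (trans (*-cong refl 1-E0≈0) (zeroʳ _))) (zeroʳ _)
          where
            1-E0≈0 : 1# - E 0 ≈ 0#
            1-E0≈0 = trans (+-cong refl (-‿cong (expS-zero (linT (ι (K.- ε)))))) (-‿inverseʳ 1#)

        -- v′ = S - ε v, since (1 - e^(-εt))′ = ε e^(-εt).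
        D-v : ∀ n → D v n ≈ S * oneS n - ι ε * v n
        D-v n = begin
          natA (suc n) * (S * (ι ε⁻¹ * (0# - E (suc n))))      ≈⟨ central-swap (natA-central (suc n)) S _ ⟨
          S * (natA (suc n) * (ι ε⁻¹ * (0# - E (suc n))))      ≈⟨ *-cong refl (central-swap (natA-central (suc n)) _ _) ⟨
          S * (ι ε⁻¹ * (natA (suc n) * (0# - E (suc n))))      ≈⟨ *-cong refl (*-cong refl natA*[0-E]) ⟩
          S * (ι ε⁻¹ * (ι ε * E n))                            ≈⟨ *-cong refl (ιε⁻¹*[ιε*x] (E n)) ⟩
          S * E n                                              ≈⟨ *-cong refl (x-[x-y]≈y (oneS n) (E n)) ⟨
          S * (oneS n - (oneS n - E n))                        ≈⟨ x[y-z]≈xy-xz _ _ _ ⟩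
          S * oneS n - S * (oneS n - E n)                      ≈⟨ +-cong refl (-‿cong ιε*v≈) ⟨
          S * oneS n - ι ε * v n                               ∎
          where
            x-[x-y]≈y : ∀ x y → x - (x - y) ≈ y
            x-[x-y]≈y x y = trans (+-cong refl (⁻¹-anti-homo‿- x y)) (trans (solve 3 (λ p q r → p ⊕ (q ⊕ r) ⊜ q ⊕ (p ⊕ r)) refl x y (- x)) (trans (+-cong refl (-‿inverseʳ x)) (+-identityʳ y)))
            natA*[0-E] : natA (suc n) * (0# - E (suc n)) ≈ ι ε * E n
            natA*[0-E] = begin
              natA (suc n) * (0# - E (suc n))  ≈⟨ *-cong refl (+-identityˡ _) ⟩
              natA (suc n) * - E (suc n)       ≈⟨ -‿distribʳ-* _ _ ⟨
              - D E n                          ≈⟨ -‿cong (D-expS-linTˡ _ n) ⟩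
              - (ι (K.- ε) * E n)              ≈⟨ -‿cong (*-cong (ι-neg ε) refl) ⟩
              - (- ι ε * E n)                  ≈⟨ -‿cong (-‿distribˡ-* _ _) ⟨
              - - (ι ε * E n)                  ≈⟨ -‿involutive _ ⟩
              ι ε * E n                        ∎
            ιε*v≈ : ι ε * v n ≈ S * (oneS n - E n)
            ιε*v≈ = trans (sym (central-swap (ι-central ε) S _)) (*-cong refl (ιε*[ιε⁻¹*x] _))

        powS-v-vanish : ∀ {m n} → n < m → V m n ≈ 0#
        powS-v-vanish {suc m} {n} (s≤s n≤m) = sumTo-≈0 n term≈0
          where
            term≈0 : ∀ i → i ≤ n → v i * V m (n ∸ i) ≈ 0#
            term≈0 zero    _     = trans (*-cong v-zero refl) (zeroˡ _)
            term≈0 (suc j) 1+j≤n = trans (*-cong refl (powS-v-vanish (ℕₚ.<-≤-trans n∸[1+j]<n n≤m))) (zeroʳ _)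
              where
                n∸[1+j]<n : n ∸ suc j < n
                n∸[1+j]<n = ℕₚ.∸-monoʳ-< {n} {suc j} {0} (s≤s z≤n) 1+j≤n

        D-v*S-powS-v : ∀ m n → (D v *S V m) n ≈ S * V m n - ι ε * V (suc m) n
        D-v*S-powS-v m n = begin
          sumTo n (λ i → D v i * V m (n ∸ i))
            ≈⟨ sumTo-cong n (λ i → trans (*-cong (D-v i) refl) ([y-z]x≈yx-zx _ _ _)) ⟩
          sumTo n (λ i → S * oneS i * V m (n ∸ i) - ι ε * v i * V m (n ∸ i))
            ≈⟨ sumTo-distrib-- n _ _ ⟩
          sumTo n (λ i → S * oneS i * V m (n ∸ i)) - sumTo n (λ i → ι ε * v i * V m (n ∸ i))
            ≈⟨ +-cong (sumTo-cong n (λ i → *-assoc _ _ _)) (-‿cong (sumTo-cong n (λ i → *-assoc _ _ _))) ⟩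
          sumTo n (λ i → S * (oneS i * V m (n ∸ i))) - sumTo n (λ i → ι ε * (v i * V m (n ∸ i)))
            ≈⟨ +-cong (*-distribˡ-sumTo n _ _) (-‿cong (*-distribˡ-sumTo n _ _)) ⟨
          S * (oneS *S V m) n - ι ε * V (suc m) n      ≈⟨ +-cong (*-cong refl (oneS-*S (V m) n)) refl ⟩
          S * V m n - ι ε * V (suc m) n                ∎

        v*[c*[S*Y-ιε*Z]] : ∀ i {c} → Central c → ∀ Y Z →
                            v i * (c * (S * Y - ι ε * Z)) ≈ c * (S * (v i * Y) - ι ε * (v i * Z))
        v*[c*[S*Y-ιε*Z]] i cc Y Z =
          trans (central-swap cc (v i) _)
                (*-cong refl (trans (x[y-z]≈xy-xz _ _ _) (+-cong (v*[S*y] i Y) (-‿cong (central-swap (ι-central ε) (v i) Z)))))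

        -- (v^(m+1))′ = (m+1) v^m v′, written out with v′ = S - ε v.
        D-powS-v : ∀ m n → D (V (suc m)) n ≈ natA (suc m) * (S * V m n - ι ε * V (suc m) n)
        D-powS-v zero n = begin
          D (v *S V 0) n                                          ≈⟨ D-*S v (V 0) n ⟩
          (D v *S V 0) n + (v *S D oneS) n
            ≈⟨ +-cong (D-v*S-powS-v 0 n) (sumTo-≈0 n (λ i _ → trans (*-cong refl (D-oneS (n ∸ i))) (zeroʳ _))) ⟩
          (S * V 0 n - ι ε * V 1 n) + 0#                          ≈⟨ +-identityʳ _ ⟩
          S * V 0 n - ι ε * V 1 n                                 ≈⟨ trans (*-cong natA-1 refl) (*-identityˡ _) ⟨
          natA 1 * (S * V 0 n - ι ε * V 1 n)                      ∎
        D-powS-v (suc k) n = begin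
          D (v *S V (suc k)) n                                    ≈⟨ D-*S v (V (suc k)) n ⟩
          (D v *S V (suc k)) n + (v *S D (V (suc k))) n            ≈⟨ +-cong (D-v*S-powS-v (suc k) n) v*S-D-powS ⟩
          X + natA (suc k) * X                                    ≈⟨ natA-suc (suc k) X ⟨
          natA (suc (suc k)) * X                                  ∎
          where
            X : Carrier
            X = S * V (suc k) n - ι ε * V (suc (suc k)) n
            v*S-D-powS : (v *S D (V (suc k))) n ≈ natA (suc k) * X
            v*S-D-powS = begin
              sumTo n (λ i → v i * D (V (suc k)) (n ∸ i))
                ≈⟨ sumTo-cong n (λ i → *-cong refl (D-powS-v k (n ∸ i))) ⟩
              sumTo n (λ i → v i * (natA (suc k) * (S * V k (n ∸ i) - ι ε * V (suc k) (n ∸ i))))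
                ≈⟨ sumTo-cong n (λ i → v*[c*[S*Y-ιε*Z]] i (natA-central (suc k)) _ _) ⟩
              sumTo n (λ i → natA (suc k) * (S * (v i * V k (n ∸ i)) - ι ε * (v i * V (suc k) (n ∸ i))))
                ≈⟨ *-distribˡ-sumTo n _ _ ⟨
              natA (suc k) * sumTo n (λ i → S * (v i * V k (n ∸ i)) - ι ε * (v i * V (suc k) (n ∸ i)))
                ≈⟨ *-cong refl (trans (sumTo-distrib-- n _ _) (+-cong (sym (*-distribˡ-sumTo n _ _)) (-‿cong (sym (*-distribˡ-sumTo n _ _))))) ⟩
              natA (suc k) * X                                    ∎

        D-G : ∀ n → D G n ≈ sumTo n (λ m → ι (invFact m) * (S * V m n - ι ε * V (suc m) n))
        D-G n = begin
          natA (suc n) * sumTo (suc n) (λ m → ι (invFact m) * V m (suc n))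
            ≈⟨ *-distribˡ-sumTo (suc n) _ _ ⟩
          sumTo (suc n) (λ m → natA (suc n) * (ι (invFact m) * V m (suc n)))
            ≈⟨ sumTo-cong (suc n) (λ m → sym (central-swap (natA-central (suc n)) _ _)) ⟩
          sumTo (suc n) t                                                       ≈⟨ sumTo-suc-head n t ⟩
          t 0 + sumTo n (λ m → t (suc m))
            ≈⟨ +-cong (trans (*-cong refl (D-oneS n)) (zeroʳ _)) (sumTo-cong n t[1+m]≈) ⟩
          0# + sumTo n (λ m → ι (invFact m) * (S * V m n - ι ε * V (suc m) n))  ≈⟨ +-identityˡ _ ⟩
          sumTo n (λ m → ι (invFact m) * (S * V m n - ι ε * V (suc m) n))       ∎
          where
            t : ℕ → Carrier
            t m = ι (invFact m) * D (V m) n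
            t[1+m]≈ : ∀ m → t (suc m) ≈ ι (invFact m) * (S * V m n - ι ε * V (suc m) n)
            t[1+m]≈ m = trans (*-cong refl (D-powS-v m n)) (trans (sym (*-assoc _ _ _)) (*-cong (invFact-suc*natA-suc m) refl))

        module _ ([B,A]≈ε[A+B] : [ B , A ] ≈ ι ε * (A + B)) where

          A*[v*Y] : ∀ i Y → A * (v i * Y) ≈ v i * (A * Y) - ι ε * (v i * Y)
          A*[v*Y] i Y = begin
            A * (S * u * Y)                     ≈⟨ *-cong refl (*-assoc _ _ _) ⟩
            A * (S * (u * Y))                   ≈⟨ *-assoc _ _ _ ⟨
            A * S * (u * Y)                     ≈⟨ *-cong (A*[A+B] [B,A]≈ε[A+B]) refl ⟩
            (S * A - ι ε * S) * (u * Y)         ≈⟨ [y-z]x≈yx-zx _ _ _ ⟩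
            S * A * (u * Y) - ι ε * S * (u * Y) ≈⟨ +-cong S*A*[u*Y]≈ (-‿cong (trans (*-assoc _ _ _) (*-cong refl (sym (*-assoc _ _ _))))) ⟩
            v i * (A * Y) - ι ε * (v i * Y)     ∎
            where
              u : Carrier
              u = shiftT A B ε ε≉0 i
              S*A*[u*Y]≈ : S * A * (u * Y) ≈ v i * (A * Y)
              S*A*[u*Y]≈ = trans (*-assoc _ _ _) (trans (*-cong refl (central-swap (shiftT-central i) A Y)) (sym (*-assoc _ _ _)))

          A*[v*Y]+[v*Y]*B : ∀ k i Y → A * Y + Y * B ≈ S * Y - natA k * (ι ε * Y) →
                            A * (v i * Y) + (v i * Y) * B ≈ S * (v i * Y) - natA (suc k) * (ι ε * (v i * Y))
          A*[v*Y]+[v*Y]*B k i Y eq = begin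
            A * W + W * B                                ≈⟨ +-cong (A*[v*Y] i Y) (*-assoc _ _ _) ⟩
            (v i * (A * Y) - ι ε * W) + v i * (Y * B)    ≈⟨ solve 3 (λ p q r → (p ⊕ q) ⊕ r ⊜ (p ⊕ r) ⊕ q) refl _ _ _ ⟩
            (v i * (A * Y) + v i * (Y * B)) - ι ε * W     ≈⟨ +-cong (sym (distribˡ _ _ _)) refl ⟩
            v i * (A * Y + Y * B) - ι ε * W              ≈⟨ +-cong (*-cong refl eq) refl ⟩
            v i * (S * Y - natA k * (ι ε * Y)) - ι ε * W ≈⟨ +-cong (trans (x[y-z]≈xy-xz _ _ _) (+-cong (v*[S*y] i Y) (-‿cong v*[k*[ε*Y]]))) refl ⟩
            (S * W - natA k * (ι ε * W)) - ι ε * W       ≈⟨ +-assoc _ _ _ ⟩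
            S * W + (- (natA k * (ι ε * W)) - ι ε * W)   ≈⟨ +-cong refl (-‿+-comm _ _) ⟩
            S * W - (natA k * (ι ε * W) + ι ε * W)       ≈⟨ +-cong refl (-‿cong (trans (+-comm _ _) (sym (natA-suc k _)))) ⟩
            S * W - natA (suc k) * (ι ε * W)             ∎
            where
              W : Carrier
              W = v i * Y
              v*[k*[ε*Y]] : v i * (natA k * (ι ε * Y)) ≈ natA k * (ι ε * W)
              v*[k*[ε*Y]] = trans (central-swap (natA-central k) (v i) _) (*-cong refl (central-swap (ι-central ε) (v i) Y))

          A*powS-v+powS-v*B : ∀ m n → A * V m n + V m n * B ≈ S * V m n - natA m * (ι ε * V m n)
          A*powS-v+powS-v*B zero n = begin
            A * oneS n + oneS n * B            ≈⟨ +-cong (sym (oneS-central n A)) refl ⟩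
            oneS n * A + oneS n * B            ≈⟨ distribˡ _ _ _ ⟨
            oneS n * S                         ≈⟨ oneS-central n S ⟩
            S * oneS n                         ≈⟨ +-identityʳ _ ⟨
            S * oneS n + 0#                    ≈⟨ +-cong refl (trans (-‿cong (zeroˡ _)) -0#≈0#) ⟨
            S * oneS n - 0# * (ι ε * oneS n)   ∎
          A*powS-v+powS-v*B (suc k) n = begin
            A * sumTo n w + sumTo n w * B                                ≈⟨ +-cong (*-distribˡ-sumTo n _ _) (*-distribʳ-sumTo n _ _) ⟩
            sumTo n (λ i → A * w i) + sumTo n (λ i → w i * B)           ≈⟨ sumTo-distrib-+ n _ _ ⟨
            sumTo n (λ i → A * w i + w i * B)
              ≈⟨ sumTo-cong n (λ i → A*[v*Y]+[v*Y]*B k i (V k (n ∸ i)) (A*powS-v+powS-v*B k (n ∸ i))) ⟩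
            sumTo n (λ i → S * w i - natA (suc k) * (ι ε * w i))        ≈⟨ sumTo-distrib-- n _ _ ⟩
            sumTo n (λ i → S * w i) - sumTo n (λ i → natA (suc k) * (ι ε * w i))
              ≈⟨ +-cong (sym (*-distribˡ-sumTo n _ _)) (-‿cong (trans (sym (*-distribˡ-sumTo n _ _)) (*-cong refl (sym (*-distribˡ-sumTo n _ _))))) ⟩
            S * sumTo n w - natA (suc k) * (ι ε * sumTo n w)            ∎
            where
              w : ℕ → Carrier
              w i = v i * V k (n ∸ i)

          G-isSolution : IsSolution A B G
          G-isSolution n = sym (begin
            A * G n + G n * B                                         ≈⟨ +-cong (*-distribˡ-sumTo n _ _) (*-distribʳ-sumTo n _ _) ⟩
            sumTo n (λ m → A * (coeff m * V m n)) + sumTo n (λ m → coeff m * V m n * B) ≈⟨ sumTo-distrib-+ n _ _ ⟨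
            sumTo n (λ m → A * (coeff m * V m n) + coeff m * V m n * B)
              ≈⟨ sumTo-cong n (λ m → trans (+-cong (central-swap (ι-central _) A _) (*-assoc _ _ _)) (sym (distribˡ _ _ _))) ⟩
            sumTo n (λ m → coeff m * (A * V m n + V m n * B))            ≈⟨ sumTo-cong n (λ m → *-cong refl (A*powS-v+powS-v*B m n)) ⟩
            sumTo n (λ m → coeff m * (S * V m n - natA m * (ι ε * V m n)))
              ≈⟨ trans (sumTo-cong n (λ m → x[y-z]≈xy-xz _ _ _)) (sumTo-distrib-- n _ _) ⟩
            sumTo n (λ m → coeff m * (S * V m n)) - sumTo n (λ m → coeff m * (natA m * (ι ε * V m n)))
              ≈⟨ +-cong refl (-‿cong (sumTo-invFact*natA-shift n (λ m → ι ε * V m n) ε*V[1+n]≈0)) ⟩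
            sumTo n (λ m → coeff m * (S * V m n)) - sumTo n (λ m → coeff m * (ι ε * V (suc m) n))
              ≈⟨ trans (sym (sumTo-distrib-- n _ _)) (sumTo-cong n (λ m → sym (x[y-z]≈xy-xz _ _ _))) ⟩
            sumTo n (λ m → coeff m * (S * V m n - ι ε * V (suc m) n))    ≈⟨ D-G n ⟨
            D G n                                                     ∎)
            where
              coeff : ℕ → Carrier
              coeff m = ι (invFact m)
              ε*V[1+n]≈0 : ι ε * V (suc n) n ≈ 0#
              ε*V[1+n]≈0 = trans (*-cong refl (powS-v-vanish (ℕₚ.n<1+n n))) (zeroʳ _)

          expProduct≈G : expProduct A B ≈S G
          expProduct≈G = IsSolution-unique (trans (expProduct-zero A B) (sym (expS-zero v)))
                                           (expProduct-isSolution A B) G-isSolution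

        v-one : v 1 ≈ S
        v-one = begin
          v 1                       ≈⟨ *-identityˡ _ ⟨
          1# * v 1                  ≈⟨ *-cong natA-1 refl ⟨
          D v 0                     ≈⟨ D-v 0 ⟩
          S * 1# - ι ε * v 0        ≈⟨ +-cong (*-identityʳ S) (-‿cong (trans (*-cong refl v-zero) (zeroʳ _))) ⟩
          S - 0#                    ≈⟨ +-cong refl -0#≈0# ⟩
          S + 0#                    ≈⟨ +-identityʳ S ⟩
          S                         ∎

        powS-v-one : V 1 1 ≈ S
        powS-v-one = begin
          v 0 * 0# + v 1 * 1#       ≈⟨ +-cong (zeroʳ _) (*-identityʳ _) ⟩
          0# + v 1                  ≈⟨ +-identityˡ _ ⟩
          v 1                       ≈⟨ v-one ⟩
          S                         ∎

        D-G-one : D G 1 ≈ S * S - ι ε * S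
        D-G-one = begin
          D G 1                     ≈⟨ D-G 1 ⟩
          ι (invFact 0) * (S * V 0 1 - ι ε * V 1 1) + ι (invFact 1) * (S * V 1 1 - ι ε * V 2 1)
            ≈⟨ +-cong (trans (*-cong ι-1 refl) (*-identityˡ _)) (trans (*-cong invFact-one refl) (*-identityˡ _)) ⟩
          (S * 0# - ι ε * V 1 1) + (S * V 1 1 - ι ε * V 2 1)
            ≈⟨ +-cong (+-cong (zeroʳ S) (-‿cong (*-cong refl powS-v-one)))
                      (+-cong (*-cong refl powS-v-one) (-‿cong (trans (*-cong refl (powS-v-vanish (ℕₚ.n<1+n 1))) (zeroʳ _)))) ⟩
          (0# - ι ε * S) + (S * S - 0#)  ≈⟨ +-cong (+-identityˡ _) (trans (+-cong refl -0#≈0#) (+-identityʳ _)) ⟩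
          - (ι ε * S) + S * S             ≈⟨ +-comm _ _ ⟩
          S * S - ι ε * S                 ∎
          where
            invFact-one : ι (invFact 1) ≈ 1#
            invFact-one = trans (sym (*-identityʳ _)) (trans (*-cong refl (sym natA-1)) (trans (invFact-suc*natA-suc 0) ι-1))

        expProduct≈G⇒[B,A] : expProduct A B ≈S G → [ B , A ] ≈ ι ε * (A + B)
        expProduct≈G⇒[B,A] F≈G = B*[A+B]⇒[B,A] (x-y≈z⇒x≈y+z′ (∙-cancelˡ (A * S) _ _ (begin
          A * S + (B * S - ι ε * S)       ≈⟨ +-assoc _ _ _ ⟨
          A * S + B * S - ι ε * S         ≈⟨ +-cong (distribʳ _ _ _) refl ⟨
          S * S - ι ε * S                 ≈⟨ D-G-one ⟨
          D G 1                           ≈⟨ D-cong F≈G 1 ⟨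
          D (expProduct A B) 1            ≈⟨ expProduct-isSolution A B 1 ⟩
          A * Φ 1 + Φ 1 * B               ≈⟨ +-cong (*-cong refl Φ1≈S) (*-cong Φ1≈S refl) ⟩
          A * S + S * B                   ∎)))
          where
            Φ : Series
            Φ = expProduct A B
            Φ1≈S : Φ 1 ≈ S
            Φ1≈S = trans (sym (trans (*-cong natA-1 refl) (*-identityˡ _)))
                         (trans (expProduct-isSolution A B 0)
                                (+-cong (trans (*-cong refl (expProduct-zero A B)) (*-identityʳ A))
                                        (trans (*-cong (expProduct-zero A B) refl) (*-identityˡ B))))
            x-y≈z⇒x≈y+z′ : ∀ {x y z} → x - y ≈ z → x ≈ z + y
            x-y≈z⇒x≈y+z′ eq = trans (x-y≈z⇒x≈y+z eq) (+-comm _ _)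

corollary4p3 : {c ℓ a ℓa : Level} (K : CommutativeRing c ℓ) (F : IsFieldChar0 K)
    (𝒜 : Algebra K a ℓa) (A B : Ring.Carrier (Algebra.algRing 𝒜)) (ε : CommutativeRing.Carrier K)
    (ε≉0 : ¬ (CommutativeRing._≈_ K ε (CommutativeRing.0# K))) →
    (Ops.CondI K F 𝒜 A B ε ε≉0 ⇔ Ops.CondII K F 𝒜 A B ε ε≉0)
    × (Ops.CondII K F 𝒜 A B ε ε≉0 ⇔ Ops.CondIII K F 𝒜 A B ε ε≉0)
corollary4p3 K F 𝒜 A B ε ε≉0 = mk⇔ I⇒II II⇒I , mk⇔ (I⇒III ∘ II⇒I) (I⇒II ∘ III⇒I)
  where
    open Ops K F 𝒜 using (CondI; CondII; CondIII)
    open Ring (Algebra.algRing 𝒜) using (trans; sym)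

    I⇒II : CondI A B ε ε≉0 → CondII A B ε ε≉0
    I⇒II [B,A]≈ε[A+B] n = trans (pow[A+B]≈stirlingSum K F 𝒜 A B ε [B,A]≈ε[A+B] n) (sym (stirling1Sum≈stirlingSum K F 𝒜 A B ε n))

    II⇒I : CondII A B ε ε≉0 → CondI A B ε ε≉0
    II⇒I eq = pow[A+B]≈stirlingSum⇒[B,A] K F 𝒜 A B ε (λ n → trans (eq n) (stirling1Sum≈stirlingSum K F 𝒜 A B ε n))

    I⇒III : CondI A B ε ε≉0 → CondIII A B ε ε≉0
    I⇒III = expProduct≈G K F 𝒜 A B ε ε≉0

    III⇒I : CondIII A B ε ε≉0 → CondI A B ε ε≉0
    III⇒I = expProduct≈G⇒[B,A] K F 𝒜 A B ε ε≉0
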